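{- Let $P\subseteq\Phi_{B_n}$ be a signed poset. The weight cone $K_P^{\mathrm{wt}}$ is pointed if and only if no connected component of $\widehat G_C(P^\vee)$ is isotropic.
   Context: $\Phi_{B_n}=\{\pm e_i\pm e_j:i<j\}\cup\{\pm e_i\}$. A signed poset is $P\subseteq\Phi_{B_n}$ with $\alpha\in P\Rightarrow-\alpha\notin P$ and $P=\mathbb{R}_{\ge0}P\cap\Phi_{B_n}$; $P^\vee=\{2\alpha/\langle\alpha,\alpha\rangle\}$. $\widehat G_C(P^\vee)$ is the partial order on $\pm[n]$ generated by $\delta i<\epsilon j$, $-\epsilon j<-\delta i$ whenever $\delta e_i-\epsilon e_j\in P^\vee$ ($i\neq j$, $\delta,\epsilon=\pm1$) and $\delta i<-\delta i$ whenever $2\delta e_i\in P^\vee$; its connected components are those of its Hasse diagram. A subset of $\pm[n]$ is isotropic if it contains no pair $i,-i$. $K_P^{\mathrm{wt}}=\{f\in\mathbb{R}^n:\langle f,\alpha\rangle\ge0\ \forall\alpha\in P\}$; a cone is pointed if it contains no line.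
   Formalization: The weight cone $K_P^{\mathrm{wt}}$ and the lines it may contain are taken over ℚ^n instead of ℝ^n, and the cone $\mathbb{R}_{\ge0}P$ in the signed-poset condition uses rational coefficients. -}

module Defs where

open import Data.Nat using (ℕ; zero; suc)
open import Data.Fin using (Fin; zero; suc; _<_; _≟_)
open import Data.Rational using (ℚ; 0ℚ; 1ℚ; _+_; _*_; -_; _≤_)
open import Data.Bool using (Bool; true; false)
open import Data.Product using (Σ; _×_; _,_; ∃)
open import Data.List using (List)
open import Data.List.Relation.Unary.All using (All)
open import Relation.Nullary using (¬_; yes; no)
open import Relation.Binary.PropositionalEquality using (_≡_; _≢_)
open import Relation.Binary.Construct.Closure.ReflexiveTransitive using (Star)
open import Relation.Binary.Construct.Closure.Equivalence using (EqClosure)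

Vecℚ : ℕ → Set
Vecℚ n = Fin n → ℚ

0v : ∀ {n} → Vecℚ n
0v _ = 0ℚ

_+v_ : ∀ {n} → Vecℚ n → Vecℚ n → Vecℚ n
(f +v g) k = f k + g k

_·v_ : ∀ {n} → ℚ → Vecℚ n → Vecℚ n
(t ·v f) k = t * f k

⟨_,_⟩ : ∀ {n} → Vecℚ n → Vecℚ n → ℚ
⟨_,_⟩ {zero}  f g = 0ℚ
⟨_,_⟩ {suc n} f g = f zero * g zero + ⟨ (λ k → f (suc k)) , (λ k → g (suc k)) ⟩

_≐_ : ∀ {n} → Vecℚ n → Vecℚ n → Set
f ≐ g = ∀ k → f k ≡ g k

e : ∀ {n} → Fin n → Vecℚ n
e i k with i ≟ k
... | yes _ = 1ℚ
... | no  _ = 0ℚ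

data Sign : Set where
  plus minus : Sign

flip : Sign → Sign
flip plus  = minus
flip minus = plus

sgn : Sign → ℚ
sgn plus  = 1ℚ
sgn minus = - 1ℚ

-- The root system Φ_{B_n} = {±e_i ± e_j : i < j} ∪ {±e_i}

data Root (n : ℕ) : Set where
  short : Sign → Fin n → Root n
  long  : (δ : Sign) (i : Fin n) (ε : Sign) (j : Fin n) → i < j → Root n

vec : ∀ {n} → Root n → Vecℚ n
vec (short δ i)        = sgn δ ·v e i
vec (long δ i ε j _)   = (sgn δ ·v e i) +v (sgn ε ·v e j)

negR : ∀ {n} → Root n → Root n
negR (short δ i)      = short (flip δ) i
negR (long δ i ε j p) = long (flip δ) i (flip ε) j p

-- coroot α^∨ = 2α/⟨α,α⟩ : ⟨α,α⟩ = 1 for short roots, 2 for long roots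
coroot : ∀ {n} → Root n → Vecℚ n
coroot (short δ i)        = (1ℚ + 1ℚ) ·v vec (short δ i)
coroot (long δ i ε j p)   = vec (long δ i ε j p)

Subset : ℕ → Set
Subset n = Root n → Bool

_∈_ : ∀ {n} → Root n → Subset n → Set
α ∈ P = P α ≡ true

-- v ∈ ℝ_{≥0} P  (nonnegative combinations, with rational coefficients)
InCone : ∀ {n} → Subset n → Vecℚ n → Set
InCone {n} P v =
  Σ (List (ℚ × Root n)) λ cs →
    All (λ { (c , α) → (0ℚ ≤ c) × (α ∈ P) }) cs ×
    (Data.List.foldr (λ { (c , α) acc → (c ·v vec α) +v acc }) 0v cs ≐ v)

record IsSignedPoset {n : ℕ} (P : Subset n) : Set where
  field
    antisym : ∀ α → α ∈ P → ¬ (negR α ∈ P)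
    -- P = ℝ_{≥0} P ∩ Φ_{B_n}   (the inclusion ⊆ is automatic)
    closed  : ∀ β → InCone P (vec β) → β ∈ P

_∈∨_ : ∀ {n} → Vecℚ n → Subset n → Set
v ∈∨ P = ∃ λ α → (α ∈ P) × (coroot α ≐ v)

SignedElt : ℕ → Set
SignedElt n = Sign × Fin n

neg : ∀ {n} → SignedElt n → SignedElt n
neg (δ , i) = (flip δ , i)

data Gen {n : ℕ} (P : Subset n) : SignedElt n → SignedElt n → Set where
  edge     : ∀ δ i ε j → i ≢ j →
             ((sgn δ ·v e i) +v ((- sgn ε) ·v e j)) ∈∨ P →
             Gen P (δ , i) (ε , j)
  edgeNeg  : ∀ δ i ε j → i ≢ j →
             ((sgn δ ·v e i) +v ((- sgn ε) ·v e j)) ∈∨ P →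
             Gen P (flip ε , j) (flip δ , i)
  edgeLoop : ∀ δ i → ((sgn δ + sgn δ) ·v e i) ∈∨ P →
             Gen P (δ , i) (flip δ , i)

_≤[_]_ : ∀ {n} → SignedElt n → Subset n → SignedElt n → Set
x ≤[ P ] y = Star (Gen P) x y

-- x and y lie in the same connected component (equivalence closure of
-- comparability; for a finite poset these are the components of the
-- Hasse diagram)
SameComponent : ∀ {n} → Subset n → SignedElt n → SignedElt n → Set
SameComponent P = EqClosure (λ x y → x ≤[ P ] y)

component : ∀ {n} → Subset n → SignedElt n → SignedElt n → Set
component P x y = SameComponent P x y

Isotropic : ∀ {n} → (SignedElt n → Set) → Set
Isotropic {n} S = ¬ (∃ λ (i : Fin n) → S (plus , i) × S (minus , i))

InWeightCone : ∀ {n} → Subset n → Vecℚ n → Set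
InWeightCone P f = ∀ α → α ∈ P → 0ℚ ≤ ⟨ f , vec α ⟩

ContainsLine : ∀ {n} → (Vecℚ n → Set) → Set
ContainsLine {n} K =
  Σ (Vecℚ n) λ x → Σ (Vecℚ n) λ d → ¬ (d ≐ 0v) × (∀ t → K (x +v (t ·v d)))

Pointed : ∀ {n} → (Vecℚ n → Set) → Set
Pointed K = ¬ ContainsLine K

{-# OPTIONS --safe #-}
module Submission where

-- The weight cone contains a line with direction d iff d is orthogonal to every root of P,
-- since an affine function of t that is bounded below is constant.  Writing d as the odd
-- function (σ , k) ↦ sgn σ · d k on ±[n], orthogonality to P says exactly that this function
-- is unchanged along every generating relation of Ĝ_C(P^∨) (the coroots of P are the edge
-- vectors), i.e. that it is constant on components.  On a component containing both i and -i
-- such a function vanishes; conversely, on an isotropic component C the function that is 1 on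
-- C, -1 on -C and 0 elsewhere is odd and constant on components, and gives a line.

open import Defs
open import Data.Nat using (ℕ)
open import Function.Bundles using (_⇔_)
open import Relation.Nullary using (¬_)

open import Data.Bool using (if_then_else_)
open import Data.Empty using (⊥)
open import Data.Fin using (Fin; zero; suc; _<_) renaming (_≟_ to _≟ᶠ_)
open import Data.Fin.Properties using (<⇒≢)
open import Data.Nat using (zero; suc)
open import Data.Product using (_,_; proj₁; proj₂)
open import Data.Rational using (ℚ; 0ℚ; 1ℚ; _+_; _*_; _-_; -_; _≤_; _≟_; ½; 1/_; NonZero; ≢-nonZero; *≤*)
import Data.Rational.Properties as ℚ
open import Algebra.Properties.Group ℚ.+-0-group using (inverseʳ-unique; x∙y⁻¹≈ε⇒x≈y)
open import Data.Rational.Solver using (module +-*-Solver)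
open import Function.Bundles using (mk⇔)
open import Relation.Binary.Construct.Closure.ReflexiveTransitive as Star using (_◅_)
open import Relation.Binary.Construct.Closure.Symmetric using (SymClosure; fwd; bwd)
import Relation.Binary.Construct.Closure.Equivalence as EqClosure
open import Relation.Binary.PropositionalEquality
  using (_≡_; _≢_; refl; sym; trans; cong; cong₂; subst; subst₂; module ≡-Reasoning)
open import Relation.Nullary using (Dec; does; yes; no; contradiction)
open import Relation.Nullary.Decidable using (decidable-stable; ¬¬-excluded-middle)

open +-*-Solver
open ≡-Reasoning

private
  variable
    n : ℕ

x≡-x⇒x≡0 : ∀ x → x ≡ - x → x ≡ 0ℚ
x≡-x⇒x≡0 x x≡-x = begin
  x             ≡⟨ solve 1 (λ x → x := con ½ :* (x :+ x)) refl x ⟩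
  ½ * (x + x)   ≡⟨ cong (λ y → ½ * (x + y)) x≡-x ⟩
  ½ * (x - x)   ≡⟨ cong (½ *_) (ℚ.+-inverseʳ x) ⟩
  ½ * 0ℚ        ≡⟨ ℚ.*-zeroʳ ½ ⟩
  0ℚ            ∎

b+-[1+b]*a⁻¹*a≡-1 : ∀ a b .{{_ : NonZero a}} → b + (- (1ℚ + b) * 1/ a) * a ≡ - 1ℚ
b+-[1+b]*a⁻¹*a≡-1 a b = begin
  b + (- (1ℚ + b) * 1/ a) * a   ≡⟨ cong (b +_) (ℚ.*-assoc (- (1ℚ + b)) (1/ a) a) ⟩
  b + - (1ℚ + b) * (1/ a * a)   ≡⟨ cong (λ y → b + - (1ℚ + b) * y) (ℚ.*-inverseˡ a) ⟩
  b + - (1ℚ + b) * 1ℚ           ≡⟨ solve 1 (λ b → b :+ :- (con 1ℚ :+ b) :* con 1ℚ := :- con 1ℚ) refl b ⟩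
  - 1ℚ                          ∎

affine-nonNegative⇒slope≡0 : ∀ a b → (∀ t → 0ℚ ≤ b + t * a) → a ≡ 0ℚ
affine-nonNegative⇒slope≡0 a b nonNeg =
  decidable-stable (a ≟ 0ℚ) λ a≢0 → negative-at-root {{≢-nonZero a≢0}}
  where
  0≰-1 : ¬ (0ℚ ≤ - 1ℚ)
  0≰-1 (*≤* ())

  negative-at-root : .{{_ : NonZero a}} → ⊥
  negative-at-root = 0≰-1 (subst (0ℚ ≤_) (b+-[1+b]*a⁻¹*a≡-1 a b) (nonNeg (- (1ℚ + b) * 1/ a)))

sgn-flip : ∀ σ x → sgn (flip σ) * x ≡ - (sgn σ * x)
sgn-flip plus  x = sym (ℚ.neg-distribˡ-* 1ℚ x)
sgn-flip minus x = solve 1 (λ x → con 1ℚ :* x := :- ((:- con 1ℚ) :* x)) refl x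

-sgn∘flip : ∀ σ → - sgn (flip σ) ≡ sgn σ
-sgn∘flip plus  = refl
-sgn∘flip minus = refl

¬¬-∀-Fin : ∀ {n} {Q : Fin n → Set} → (∀ k → ¬ ¬ Q k) → ¬ ¬ (∀ k → Q k)
¬¬-∀-Fin {zero}  ¬¬Q ¬∀Q = ¬∀Q λ ()
¬¬-∀-Fin {suc n} ¬¬Q ¬∀Q = ¬¬Q zero λ Q0 → ¬¬-∀-Fin (λ k → ¬¬Q (suc k)) λ Qsuc →
  ¬∀Q λ { zero → Q0 ; (suc k) → Qsuc k }

⟨⟩-congʳ : ∀ {n} (f : Vecℚ n) {g g′ : Vecℚ n} → g ≐ g′ → ⟨ f , g ⟩ ≡ ⟨ f , g′ ⟩
⟨⟩-congʳ {zero}  f g≐g′ = refl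
⟨⟩-congʳ {suc n} f g≐g′ =
  cong₂ _+_ (cong (f zero *_) (g≐g′ zero)) (⟨⟩-congʳ (λ k → f (suc k)) (λ k → g≐g′ (suc k)))

⟨⟩-comm : ∀ {n} (f g : Vecℚ n) → ⟨ f , g ⟩ ≡ ⟨ g , f ⟩
⟨⟩-comm {zero}  f g = refl
⟨⟩-comm {suc n} f g =
  cong₂ _+_ (ℚ.*-comm (f zero) (g zero)) (⟨⟩-comm (λ k → f (suc k)) (λ k → g (suc k)))

⟨⟩-zeroˡ : ∀ {n} (g : Vecℚ n) → ⟨ 0v , g ⟩ ≡ 0ℚ
⟨⟩-zeroˡ {zero}  g = refl
⟨⟩-zeroˡ {suc n} g = begin
  0ℚ * g zero + ⟨ 0v , (λ k → g (suc k)) ⟩   ≡⟨ cong₂ _+_ (ℚ.*-zeroˡ (g zero)) (⟨⟩-zeroˡ (λ k → g (suc k))) ⟩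
  0ℚ + 0ℚ                                    ≡⟨ ℚ.+-identityʳ 0ℚ ⟩
  0ℚ                                         ∎

⟨⟩-zeroʳ : (f : Vecℚ n) → ⟨ f , 0v ⟩ ≡ 0ℚ
⟨⟩-zeroʳ f = trans (⟨⟩-comm f 0v) (⟨⟩-zeroˡ f)

⟨⟩-distribʳ-+v : ∀ {n} (f g h : Vecℚ n) → ⟨ f +v g , h ⟩ ≡ ⟨ f , h ⟩ + ⟨ g , h ⟩
⟨⟩-distribʳ-+v {zero}  f g h = refl
⟨⟩-distribʳ-+v {suc n} f g h
  rewrite ⟨⟩-distribʳ-+v (λ k → f (suc k)) (λ k → g (suc k)) (λ k → h (suc k)) =
  solve 5 (λ a b c x y → (a :+ b) :* c :+ (x :+ y) := (a :* c :+ x) :+ (b :* c :+ y))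
    refl (f zero) (g zero) (h zero) _ _

⟨⟩-distribˡ-+v : (f g h : Vecℚ n) → ⟨ f , g +v h ⟩ ≡ ⟨ f , g ⟩ + ⟨ f , h ⟩
⟨⟩-distribˡ-+v f g h = begin
  ⟨ f , g +v h ⟩          ≡⟨ ⟨⟩-comm f (g +v h) ⟩
  ⟨ g +v h , f ⟩          ≡⟨ ⟨⟩-distribʳ-+v g h f ⟩
  ⟨ g , f ⟩ + ⟨ h , f ⟩   ≡⟨ cong₂ _+_ (⟨⟩-comm g f) (⟨⟩-comm h f) ⟩
  ⟨ f , g ⟩ + ⟨ f , h ⟩   ∎

⟨⟩-scaleˡ : ∀ {n} t (f g : Vecℚ n) → ⟨ t ·v f , g ⟩ ≡ t * ⟨ f , g ⟩
⟨⟩-scaleˡ {zero}  t f g = sym (ℚ.*-zeroʳ t)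
⟨⟩-scaleˡ {suc n} t f g rewrite ⟨⟩-scaleˡ t (λ k → f (suc k)) (λ k → g (suc k)) =
  solve 4 (λ t a c x → (t :* a) :* c :+ t :* x := t :* (a :* c :+ x)) refl t (f zero) (g zero) _

⟨⟩-scaleʳ : ∀ t (f g : Vecℚ n) → ⟨ f , t ·v g ⟩ ≡ t * ⟨ f , g ⟩
⟨⟩-scaleʳ t f g = begin
  ⟨ f , t ·v g ⟩   ≡⟨ ⟨⟩-comm f (t ·v g) ⟩
  ⟨ t ·v g , f ⟩   ≡⟨ ⟨⟩-scaleˡ t g f ⟩
  t * ⟨ g , f ⟩    ≡⟨ cong (t *_) (⟨⟩-comm g f) ⟩
  t * ⟨ f , g ⟩    ∎

e-suc : (i k : Fin n) → e (suc i) (suc k) ≡ e i k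
e-suc i k with i ≟ᶠ k
... | yes _ = refl
... | no  _ = refl

⟨⟩-e : ∀ {n} (f : Vecℚ (suc n)) i → ⟨ f , e i ⟩ ≡ f i
⟨⟩-e f zero = begin
  f zero * 1ℚ + ⟨ (λ k → f (suc k)) , 0v ⟩   ≡⟨ cong₂ _+_ (ℚ.*-identityʳ (f zero)) (⟨⟩-zeroʳ (λ k → f (suc k))) ⟩
  f zero + 0ℚ                                ≡⟨ ℚ.+-identityʳ (f zero) ⟩
  f zero                                     ∎
⟨⟩-e {suc n} f (suc i) = begin
  f zero * 0ℚ + ⟨ (λ k → f (suc k)) , (λ k → e (suc i) (suc k)) ⟩
    ≡⟨ cong₂ _+_ (ℚ.*-zeroʳ (f zero)) (⟨⟩-congʳ (λ k → f (suc k)) (e-suc i)) ⟩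
  0ℚ + ⟨ (λ k → f (suc k)) , e i ⟩
    ≡⟨ ℚ.+-identityˡ _ ⟩
  ⟨ (λ k → f (suc k)) , e i ⟩
    ≡⟨ ⟨⟩-e (λ k → f (suc k)) i ⟩
  f (suc i)
    ∎

⟨⟩-scaled-e : ∀ (d : Vecℚ n) a i → ⟨ d , a ·v e i ⟩ ≡ a * d i
⟨⟩-scaled-e {suc n} d a i = trans (⟨⟩-scaleʳ a d (e i)) (cong (a *_) (⟨⟩-e d i))

⟨⟩-pair : ∀ (d : Vecℚ n) a i b j → ⟨ d , (a ·v e i) +v (b ·v e j) ⟩ ≡ a * d i + b * d j
⟨⟩-pair d a i b j = trans (⟨⟩-distribˡ-+v d (a ·v e i) (b ·v e j))
                          (cong₂ _+_ (⟨⟩-scaled-e d a i) (⟨⟩-scaled-e d b j))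

_⟂_ : Vecℚ n → Subset n → Set
d ⟂ P = ∀ α → α ∈ P → ⟨ d , vec α ⟩ ≡ 0ℚ

lineDirection-⟂ : ∀ {P : Subset n} {x d} → (∀ t → InWeightCone P (x +v (t ·v d))) → d ⟂ P
lineDirection-⟂ {x = x} {d} onLine α α∈P =
  affine-nonNegative⇒slope≡0 ⟨ d , vec α ⟩ ⟨ x , vec α ⟩ λ t →
    subst (0ℚ ≤_) (value t) (onLine t α α∈P)
  where
  value : ∀ t → ⟨ x +v (t ·v d) , vec α ⟩ ≡ ⟨ x , vec α ⟩ + t * ⟨ d , vec α ⟩
  value t = trans (⟨⟩-distribʳ-+v x (t ·v d) (vec α)) (cong (⟨ x , vec α ⟩ +_) (⟨⟩-scaleˡ t d (vec α)))

⟂⇒containsLine : ∀ {P : Subset n} {d} → ¬ (d ≐ 0v) → d ⟂ P → ContainsLine (InWeightCone P)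
⟂⇒containsLine {d = d} d≢0 d⟂P = 0v , d , d≢0 , λ t α α∈P → ℚ.≤-reflexive (sym (begin
  ⟨ 0v +v (t ·v d) , vec α ⟩             ≡⟨ ⟨⟩-distribʳ-+v 0v (t ·v d) (vec α) ⟩
  ⟨ 0v , vec α ⟩ + ⟨ t ·v d , vec α ⟩    ≡⟨ cong₂ _+_ (⟨⟩-zeroˡ (vec α)) (⟨⟩-scaleˡ t d (vec α)) ⟩
  0ℚ + t * ⟨ d , vec α ⟩                 ≡⟨ cong (λ y → 0ℚ + t * y) (d⟂P α α∈P) ⟩
  0ℚ + t * 0ℚ                            ≡⟨ solve 1 (λ t → con 0ℚ :+ t :* con 0ℚ := con 0ℚ) refl t ⟩
  0ℚ                                     ∎))

Invariant : ∀ {B : Set} → Subset n → (SignedElt n → B) → Set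
Invariant P g = ∀ {y z} → Gen P y z → g y ≡ g z

module _ {B : Set} {P : Subset n} {g : SignedElt n → B} (g-inv : Invariant P g) where

  invariant-≤ : ∀ {y z} → y ≤[ P ] z → g y ≡ g z
  invariant-≤ = Star.fold (λ y z → g y ≡ g z) (λ r eq → trans (g-inv r) eq) refl

  invariant-component : ∀ {y z} → SameComponent P y z → g y ≡ g z
  invariant-component = Star.fold (λ y z → g y ≡ g z) step refl
    where
    step : ∀ {x y z} → SymClosure (_≤[ P ]_) x y → g y ≡ g z → g x ≡ g z
    step (fwd r) eq = trans (invariant-≤ r) eq
    step (bwd r) eq = trans (sym (invariant-≤ r)) eq

neg-involutive : (y : SignedElt n) → neg (neg y) ≡ y
neg-involutive (plus  , i) = refl
neg-involutive (minus , i) = refl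

Gen-neg : ∀ {P : Subset n} {y z} → Gen P y z → Gen P (neg z) (neg y)
Gen-neg (edge δ i ε j i≢j m)    = edgeNeg δ i ε j i≢j m
Gen-neg (edgeNeg δ i ε j i≢j m) =
  subst₂ (Gen _) (sym (neg-involutive (δ , i))) (sym (neg-involutive (ε , j))) (edge δ i ε j i≢j m)
Gen-neg (edgeLoop δ i m)        =
  subst (λ y → Gen _ y (flip δ , i)) (sym (neg-involutive (δ , i))) (edgeLoop δ i m)

signedCoord : Vecℚ n → SignedElt n → ℚ
signedCoord d (σ , k) = sgn σ * d k

signedCoord-neg : ∀ (d : Vecℚ n) y → signedCoord d (neg y) ≡ - signedCoord d y
signedCoord-neg d (σ , k) = sgn-flip σ (d k)

module _ (d : Vecℚ n) where

  ⟨⟩-short : ∀ δ i → ⟨ d , vec (short δ i) ⟩ ≡ signedCoord d (δ , i)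
  ⟨⟩-short δ i = ⟨⟩-scaled-e d (sgn δ) i

  ⟨⟩-long : ∀ δ i ε j (i<j : i < j) →
            ⟨ d , vec (long δ i ε j i<j) ⟩ ≡ signedCoord d (δ , i) + signedCoord d (ε , j)
  ⟨⟩-long δ i ε j _ = ⟨⟩-pair d (sgn δ) i (sgn ε) j

  ⟨⟩-edge : ∀ δ i ε j →
            ⟨ d , (sgn δ ·v e i) +v ((- sgn ε) ·v e j) ⟩ ≡ signedCoord d (δ , i) - signedCoord d (ε , j)
  ⟨⟩-edge δ i ε j = trans (⟨⟩-pair d (sgn δ) i (- sgn ε) j)
                          (cong (signedCoord d (δ , i) +_) (sym (ℚ.neg-distribˡ-* (sgn ε) (d j))))

  ⟨⟩-loop : ∀ δ i → ⟨ d , (sgn δ + sgn δ) ·v e i ⟩ ≡ signedCoord d (δ , i) + signedCoord d (δ , i)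
  ⟨⟩-loop δ i = trans (⟨⟩-scaled-e d (sgn δ + sgn δ) i) (ℚ.*-distribʳ-+ (d i) (sgn δ) (sgn δ))

coroot-short : ∀ δ (i : Fin n) → coroot (short δ i) ≐ ((sgn δ + sgn δ) ·v e i)
coroot-short δ i k =
  solve 2 (λ s x → (con 1ℚ :+ con 1ℚ) :* (s :* x) := (s :+ s) :* x) refl (sgn δ) (e i k)

coroot-long : ∀ δ (i : Fin n) ε j (i<j : i < j) →
              coroot (long δ i ε j i<j) ≐ ((sgn δ ·v e i) +v ((- sgn (flip ε)) ·v e j))
coroot-long δ i ε j _ k = cong (λ s → sgn δ * e i k + s * e j k) (sym (-sgn∘flip ε))

⟂-coroot : ∀ {P : Subset n} {d v} → d ⟂ P → v ∈∨ P → ⟨ d , v ⟩ ≡ 0ℚ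
⟂-coroot {P = P} {d} d⟂P (α , α∈P , α∨≐v) =
  trans (⟨⟩-congʳ d (λ k → sym (α∨≐v k))) (coroot-⟂ α α∈P)
  where
  coroot-⟂ : ∀ β → β ∈ P → ⟨ d , coroot β ⟩ ≡ 0ℚ
  coroot-⟂ (short δ i) β∈P = begin
    ⟨ d , (1ℚ + 1ℚ) ·v vec (short δ i) ⟩   ≡⟨ ⟨⟩-scaleʳ (1ℚ + 1ℚ) d (vec (short δ i)) ⟩
    (1ℚ + 1ℚ) * ⟨ d , vec (short δ i) ⟩    ≡⟨ cong ((1ℚ + 1ℚ) *_) (d⟂P _ β∈P) ⟩
    (1ℚ + 1ℚ) * 0ℚ                         ≡⟨ ℚ.*-zeroʳ (1ℚ + 1ℚ) ⟩
    0ℚ                                     ∎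
  coroot-⟂ (long δ i ε j i<j) β∈P = d⟂P _ β∈P

⟂-edge : ∀ {P : Subset n} {d} δ i ε j → d ⟂ P → ((sgn δ ·v e i) +v ((- sgn ε) ·v e j)) ∈∨ P →
         signedCoord d (δ , i) ≡ signedCoord d (ε , j)
⟂-edge {d = d} δ i ε j d⟂P m = x∙y⁻¹≈ε⇒x≈y _ _ (trans (sym (⟨⟩-edge d δ i ε j)) (⟂-coroot d⟂P m))

⟂⇒invariant : ∀ {P : Subset n} {d} → d ⟂ P → Invariant P (signedCoord d)
⟂⇒invariant d⟂P (edge δ i ε j _ m) = ⟂-edge δ i ε j d⟂P m
⟂⇒invariant {d = d} d⟂P (edgeNeg δ i ε j _ m) = begin
  signedCoord d (neg (ε , j))   ≡⟨ signedCoord-neg d (ε , j) ⟩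
  - signedCoord d (ε , j)       ≡⟨ cong -_ (sym (⟂-edge δ i ε j d⟂P m)) ⟩
  - signedCoord d (δ , i)       ≡⟨ sym (signedCoord-neg d (δ , i)) ⟩
  signedCoord d (neg (δ , i))   ∎
⟂⇒invariant {d = d} d⟂P (edgeLoop δ i m) =
  trans (inverseʳ-unique _ _ (trans (sym (⟨⟩-loop d δ i)) (⟂-coroot d⟂P m)))
        (sym (signedCoord-neg d (δ , i)))

invariant⇒⟂ : ∀ {P : Subset n} {d} → Invariant P (signedCoord d) → d ⟂ P
invariant⇒⟂ {P = P} {d} inv (short δ i) α∈P = begin
  ⟨ d , vec (short δ i) ⟩   ≡⟨ ⟨⟩-short d δ i ⟩
  signedCoord d (δ , i)     ≡⟨ x≡-x⇒x≡0 _ (trans (inv loop) (signedCoord-neg d (δ , i))) ⟩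
  0ℚ                        ∎
  where
  loop : Gen P (δ , i) (flip δ , i)
  loop = edgeLoop δ i (short δ i , α∈P , coroot-short δ i)
invariant⇒⟂ {P = P} {d} inv (long δ i ε j i<j) α∈P = begin
  ⟨ d , vec (long δ i ε j i<j) ⟩
    ≡⟨ ⟨⟩-long d δ i ε j i<j ⟩
  signedCoord d (δ , i) + signedCoord d (ε , j)
    ≡⟨ cong (_+ signedCoord d (ε , j)) (trans (inv arrow) (signedCoord-neg d (ε , j))) ⟩
  - signedCoord d (ε , j) + signedCoord d (ε , j)
    ≡⟨ ℚ.+-inverseˡ (signedCoord d (ε , j)) ⟩
  0ℚ
    ∎
  where
  arrow : Gen P (δ , i) (flip ε , j)
  arrow = edge δ i (flip ε) j (<⇒≢ i<j) (long δ i ε j i<j , α∈P , coroot-long δ i ε j i<j)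

Gen⇒SameComponent : ∀ {P : Subset n} {y z} → Gen P y z → SameComponent P y z
Gen⇒SameComponent r = fwd (r ◅ Star.ε) ◅ Star.ε

isotropic-neg : ∀ {S : SignedElt n → Set} → Isotropic S → ∀ {y} → S y → ¬ S (neg y)
isotropic-neg iso {plus  , i} Sy S-y = iso (i , Sy , S-y)
isotropic-neg iso {minus , i} Sy S-y = iso (i , S-y , Sy)

invariant-nonIsotropic⇒signedCoord≡0 : ∀ {P : Subset n} {d} y → Invariant P (signedCoord d) →
                                       ¬ Isotropic (component P y) → signedCoord d y ≡ 0ℚ
invariant-nonIsotropic⇒signedCoord≡0 {d = d} y inv nonIso =
  decidable-stable (signedCoord d y ≟ 0ℚ) λ ≢0 → nonIso λ { (i , y~+i , y~-i) →
    ≢0 (x≡-x⇒x≡0 _ (begin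
      signedCoord d y                  ≡⟨ invariant-component inv y~-i ⟩
      signedCoord d (neg (plus , i))   ≡⟨ signedCoord-neg d (plus , i) ⟩
      - signedCoord d (plus , i)       ≡⟨ cong -_ (sym (invariant-component inv y~+i)) ⟩
      - signedCoord d y                ∎)) }

indicator : ∀ {A : Set} → Dec A → ℚ
indicator a? = if does a? then 1ℚ else 0ℚ

indicator-yes : ∀ {A : Set} → A → (a? : Dec A) → indicator a? ≡ 1ℚ
indicator-yes a (yes _) = refl
indicator-yes a (no ¬a) = contradiction a ¬a

indicator-no : ∀ {A : Set} → ¬ A → (a? : Dec A) → indicator a? ≡ 0ℚ
indicator-no ¬a (yes a) = contradiction a ¬a
indicator-no ¬a (no _)  = refl

indicator-cong : ∀ {A B : Set} → (A → B) → (B → A) →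
                 (a? : Dec A) (b? : Dec B) → indicator a? ≡ indicator b?
indicator-cong A→B B→A (yes a)  b? = sym (indicator-yes (A→B a) b?)
indicator-cong A→B B→A (no ¬a) b? = sym (indicator-no (λ b → ¬a (B→A b)) b?)

¬¬-decidable : (C : SignedElt n → Set) → ¬ ¬ (∀ y → Dec (C y))
¬¬-decidable C ¬dec =
  ¬¬-∀-Fin (λ _ → ¬¬-excluded-middle) λ plus? →
  ¬¬-∀-Fin (λ _ → ¬¬-excluded-middle) λ minus? →
  ¬dec λ { (plus , k) → plus? k ; (minus , k) → minus? k }

module SignedIndicator {P : Subset n} (x : SignedElt n) (member? : ∀ y → Dec (SameComponent P x y)) where

  𝟙 : SignedElt n → ℚ
  𝟙 y = indicator (member? y)

  χ : Vecℚ n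
  χ k = 𝟙 (plus , k) - 𝟙 (minus , k)

  signedCoord-χ : ∀ y → signedCoord χ y ≡ 𝟙 y - 𝟙 (neg y)
  signedCoord-χ (plus  , k) = ℚ.*-identityˡ (χ k)
  signedCoord-χ (minus , k) =
    solve 2 (λ a b → (:- con 1ℚ) :* (a :- b) := b :- a) refl (𝟙 (plus , k)) (𝟙 (minus , k))

  𝟙-invariant : Invariant P 𝟙
  𝟙-invariant {y} {z} r = indicator-cong (λ x~y → EqClosure.transitive _ x~y y~z)
                                         (λ x~z → EqClosure.transitive _ x~z (EqClosure.symmetric _ y~z))
                                         (member? y) (member? z)
    where
    y~z : SameComponent P y z
    y~z = Gen⇒SameComponent r

  χ-invariant : Invariant P (signedCoord χ)
  χ-invariant {y} {z} r = begin
    signedCoord χ y   ≡⟨ signedCoord-χ y ⟩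
    𝟙 y - 𝟙 (neg y)   ≡⟨ cong₂ _-_ (𝟙-invariant r) (sym (𝟙-invariant (Gen-neg r))) ⟩
    𝟙 z - 𝟙 (neg z)   ≡⟨ sym (signedCoord-χ z) ⟩
    signedCoord χ z   ∎

  χ≢0 : Isotropic (component P x) → ¬ (χ ≐ 0v)
  χ≢0 iso χ≐0 = 1≢0 (begin
    1ℚ                       ≡⟨ cong₂ _-_ (sym 𝟙x≡1) (sym 𝟙-x≡0) ⟩
    𝟙 x - 𝟙 (neg x)          ≡⟨ sym (signedCoord-χ x) ⟩
    signedCoord χ x          ≡⟨ cong (sgn (proj₁ x) *_) (χ≐0 (proj₂ x)) ⟩
    sgn (proj₁ x) * 0ℚ       ≡⟨ ℚ.*-zeroʳ (sgn (proj₁ x)) ⟩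
    0ℚ                       ∎)
    where
    1≢0 : 1ℚ ≢ 0ℚ
    1≢0 ()

    𝟙x≡1 : 𝟙 x ≡ 1ℚ
    𝟙x≡1 = indicator-yes Star.ε (member? x)

    𝟙-x≡0 : 𝟙 (neg x) ≡ 0ℚ
    𝟙-x≡0 = indicator-no (isotropic-neg {S = component P x} iso Star.ε) (member? (neg x))

mainTheorem10 : (n : ℕ) (P : Subset n) → IsSignedPoset P →
    Pointed (InWeightCone P) ⇔ (∀ x → ¬ Isotropic (component P x))
mainTheorem10 n P _ = mk⇔ pointed⇒noIsotropic noIsotropic⇒pointed
  where
  -- Membership in a component need not be decidable, but the goal is ⊥, so excluded
  -- middle for the finitely many points of ±[n] is available.
  pointed⇒noIsotropic : Pointed (InWeightCone P) → ∀ x → ¬ Isotropic (component P x)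
  pointed⇒noIsotropic pointed x iso = ¬¬-decidable (SameComponent P x) λ member? →
    let open SignedIndicator x member? in
    pointed (⟂⇒containsLine (χ≢0 iso) (invariant⇒⟂ χ-invariant))

  noIsotropic⇒pointed : (∀ x → ¬ Isotropic (component P x)) → Pointed (InWeightCone P)
  noIsotropic⇒pointed noIso (x , d , d≢0 , onLine) = d≢0 λ k →
    trans (sym (ℚ.*-identityˡ (d k)))
          (invariant-nonIsotropic⇒signedCoord≡0 (plus , k) d-inv (noIso (plus , k)))
    where
    d-inv : Invariant P (signedCoord d)
    d-inv = ⟂⇒invariant (lineDirection-⟂ {x = x} onLine)
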